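{- Let $q=p^h$, $p$ prime, and let $M$ be a multiset of points in $\mathrm{AG}(2,q)$ such that $(\infty)$ is a mod-special direction. Let $E\subseteq\mathbb F_q$ be the set of mod-equidistributed directions of $M$, and for $e\in E$ let $r_e\in\mathbb F_p$ be the constant value of $\mathrm{pr}_{M,e}$. Define $$F_M(T,D,B)=\sum_{(x,y)\in M}\bigl(1-(yT-(Dx+B))^{q-1}\bigr)-\sum_{e\in E}r_e\bigl(1-(D-eT)^{q-1}\bigr)\in\mathbb F_q[T,D,B].$$ Then for all $d,b\in\mathbb F_q$: $F_M(1,d,b)=\mathrm{pr}_{M,d}(b)$ if $d\notin E$, $F_M(1,d,b)=0$ if $d\in E$, and $F_M(0,1,b)=\mathrm{pr}_{M,\infty}(b)$.
   Context: Points of $\mathrm{AG}(2,q)$ are vectors $(x,y)\in\mathbb F_q^2$; lines with slope $d\in\mathbb F_q$ are $Y=dX+b$, with slope $\infty$ are $X+b=0$. Sums over a multiset count multiplicities. $\mathrm{pr}_{M,d}:\mathbb F_q\to\mathbb F_p$ maps $b$ to the number of points of $M$ (with multiplicity) on $Y=dX+b$ (or $X+b=0$ if $d=\infty$) modulo $p$. A direction is mod-equidistributed if $\mathrm{pr}_{M,d}$ is constant, and mod-special otherwise. -}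

module Defs where

open import Level using (0ℓ)
open import Data.Nat as ℕ using (ℕ; zero; suc; NonZero)
open import Data.Nat.DivMod using (_%_)
open import Data.Fin using (Fin)
open import Data.List using (List; []; _∷_; length; filter; map; allFin; foldr)
open import Data.List.Relation.Unary.All using (All)
open import Data.List.Relation.Unary.All using () renaming (all? to allDec?)
open import Data.Product using (_×_; _,_; proj₁; proj₂; ∃)
open import Data.Bool using (Bool; true; false; if_then_else_)
open import Relation.Nullary using (¬_; Dec; does)
open import Relation.Binary.PropositionalEquality using (_≡_; _≢_)
open import Relation.Binary.Definitions using (DecidableEquality)
open import Algebra.Structures using (IsCommutativeRing)
open import Function.Bundles using (_↔_; Inverse)

record FiniteField : Set₁ where
  infixl 6 _+_ _-_
  infixl 7 _*_
  field
    Carrier : Set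
    _+_ _*_ : Carrier → Carrier → Carrier
    -_      : Carrier → Carrier
    0# 1#   : Carrier
    isCommutativeRing : IsCommutativeRing _≡_ _+_ _*_ -_ 0# 1#
    0≢1     : 0# ≢ 1#
    inverse : ∀ x → x ≢ 0# → ∃ λ y → x * y ≡ 1#
    _≟_     : DecidableEquality Carrier
    size    : ℕ
    enum    : Fin size ↔ Carrier

  _-_ : Carrier → Carrier → Carrier
  x - y = x + (- y)

  _^_ : Carrier → ℕ → Carrier
  x ^ zero  = 1#
  x ^ suc n = x * (x ^ n)

  ι : ℕ → Carrier
  ι zero    = 0#
  ι (suc n) = 1# + ι n

  elements : List Carrier
  elements = map (Inverse.to enum) (allFin size)

  sumL : List Carrier → Carrier
  sumL = foldr _+_ 0#

-- Everything below is relative to a finite field F and a prime p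
-- (the characteristic), with q = size F.
module AG2 (F : FiniteField) (p : ℕ) .{{_ : NonZero p}} where
  open FiniteField F

  q : ℕ
  q = size

  Point : Set
  Point = Carrier × Carrier

  -- multisets of points of AG(2,q): lists (multiplicity = number of occurrences)
  Multiset : Set
  Multiset = List Point

  countLine : Multiset → Carrier → Carrier → ℕ
  countLine M d b = length (filter (λ pt → proj₂ pt ≟ ((d * proj₁ pt) + b)) M)

  countVert : Multiset → Carrier → ℕ
  countVert M b = length (filter (λ pt → (proj₁ pt + b) ≟ 0#) M)

  -- pr_{M,d}(b) ∈ F_p, elements of F_p represented as naturals in {0,…,p-1}
  pr : Multiset → Carrier → Carrier → ℕ
  pr M d b = countLine M d b % p

  pr∞ : Multiset → Carrier → ℕ
  pr∞ M b = countVert M b % p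

  ModEquidistributed : Multiset → Carrier → Set
  ModEquidistributed M d = ∀ b b′ → pr M d b ≡ pr M d b′

  ModEquidistributed∞ : Multiset → Set
  ModEquidistributed∞ M = ∀ b b′ → pr∞ M b ≡ pr∞ M b′

  inE : Multiset → Carrier → Bool
  inE M d = does (allDec? (λ b → pr M d b ℕ.≟ pr M d 0#) elements)

  r : Multiset → Carrier → ℕ
  r M e = pr M e 0#

  FM : Multiset → Carrier → Carrier → Carrier → Carrier
  FM M T D B =
      sumL (map (λ pt → 1# - (((proj₂ pt * T) - ((D * proj₁ pt) + B)) ^ (q ℕ.∸ 1))) M)
    - sumL (map (λ e → if inE M e
                         then ι (r M e) * (1# - ((D - (e * T)) ^ (q ℕ.∸ 1)))
                         else 0#) elements)

{-# OPTIONS --safe #-}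
-- In F_q one has z^(q-1) = 1 for z ≠ 0 (Fermat) and 0^(q-1) = 0, so 1 - z^(q-1) is the
-- indicator of z = 0.  Hence at (T,D,B) = (1,d,b) the first sum of F_M counts, in F_q, the
-- points of M on Y = dX + b, while the second sum collapses to its term e = d; at (0,1,b)
-- the first sum counts the points on X + b = 0 and every term of the second vanishes.
-- Counts read in F_q only depend on their residue mod p, because q · 1 = 0 (the sum of all
-- elements is invariant under x ↦ x + 1) and F_q has no zero divisors, so p · 1 = 0.
module Submission where

open import Defs
open import Data.Nat using (ℕ; NonZero; _^_)
open import Data.Nat.Primality using (Prime)
open import Data.Product using (_×_)
open import Data.List using (List)
open import Relation.Nullary using (¬_)
open import Relation.Binary.PropositionalEquality using (_≡_)

open import Level using (0ℓ)
import Data.Nat as ℕ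
open import Data.Nat.Properties using (m<n⇒0<n∸m)
open import Data.Nat.DivMod using (_%_; _/_; m≡m%n+[m/n]*n)
open import Data.Fin using (Fin; zero; suc; punchIn)
open import Data.Fin.Properties using (punchInᵢ≢i)
open import Data.Vec.Functional using (Vector; replicate)
open import Data.List using ([]; _∷_; map; tabulate; length; filter; allFin)
open import Data.List.Properties using (map-∘; map-tabulate)
open import Data.List.Relation.Unary.All as All using (All)
open import Data.List.Membership.Propositional using (_∈_)
open import Data.List.Membership.Propositional.Properties using (∈-map⁺; ∈-allFin)
open import Data.Product using (_,_; proj₁; proj₂)
open import Data.Bool using (true; false; if_then_else_)
open import Function using (_∘_; id)
open import Function.Bundles using (_↔_; Inverse; mk↔ₛ′)
open import Function.Construct.Composition using (_↔-∘_)
open import Function.Construct.Symmetry using (↔-sym)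
open import Relation.Nullary using (Dec; yes; no; does)
open import Relation.Nullary.Decidable using (map′; dec-true; dec-false)
open import Relation.Unary using (Pred; Decidable)
open import Relation.Binary.PropositionalEquality using (_≢_; refl; sym; trans; cong; cong₂; subst; module ≡-Reasoning)
open import Data.Empty using (⊥-elim)
open import Algebra.Bundles using (CommutativeMonoid; CommutativeRing)
import Algebra.Properties.CommutativeMonoid.Sum as Sum
import Algebra.Properties.Ring as RingProperties
import Algebra.Properties.Semiring.Mult as SemiringMult

i≢j⇒1<n : ∀ {n} {i j : Fin n} → i ≢ j → 1 ℕ.< n
i≢j⇒1<n {ℕ.suc ℕ.zero} {zero} {zero} i≢j = ⊥-elim (i≢j refl)
i≢j⇒1<n {ℕ.suc (ℕ.suc n)} _ = ℕ.s≤s (ℕ.s≤s ℕ.z≤n)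

module FiniteFieldProperties (F : FiniteField) where
  open FiniteField F renaming (_^_ to _^ᶠ_)

  commutativeRing : CommutativeRing 0ℓ 0ℓ
  commutativeRing = record { isCommutativeRing = isCommutativeRing }

  open CommutativeRing commutativeRing using (+-identityˡ; +-identityʳ; -‿inverseʳ; *-identityˡ; *-identityʳ; *-assoc; *-comm; zeroˡ; zeroʳ)
  open CommutativeRing commutativeRing using (+-commutativeMonoid; *-commutativeMonoid; semiring; ring)
  open RingProperties ring using (//-rightDividesˡ; //-rightDividesʳ; -0#≈0#; -‿injective; +-identityʳ-unique)
  open SemiringMult semiring using (×-homo-+; ×1-homo-*) renaming (_×_ to _·_)
  module Σ = Sum +-commutativeMonoid
  module Π = Sum *-commutativeMonoid
  open ≡-Reasoning

  x-0≡x : ∀ x → x - 0# ≡ x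
  x-0≡x x = trans (cong (x +_) -0#≈0#) (+-identityʳ x)

  -x≡0⇒x≡0 : ∀ {x} → - x ≡ 0# → x ≡ 0#
  -x≡0⇒x≡0 -x≡0 = -‿injective (trans -x≡0 (sym -0#≈0#))

  *-cancelʳ : ∀ {x y z} → z ≢ 0# → x * z ≡ y * z → x ≡ y
  *-cancelʳ {x} {y} {z} z≢0 xz≡yz with inverse z z≢0
  ... | z⁻¹ , zz⁻¹≡1 = begin
    x             ≡⟨ sym (*-identityʳ x) ⟩
    x * 1#        ≡⟨ cong (x *_) (sym zz⁻¹≡1) ⟩
    x * (z * z⁻¹) ≡⟨ sym (*-assoc x z z⁻¹) ⟩
    x * z * z⁻¹   ≡⟨ cong (_* z⁻¹) xz≡yz ⟩
    y * z * z⁻¹   ≡⟨ *-assoc y z z⁻¹ ⟩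
    y * (z * z⁻¹) ≡⟨ cong (y *_) zz⁻¹≡1 ⟩
    y * 1#        ≡⟨ *-identityʳ y ⟩
    y             ∎

  x*y≡0⇒x≡0 : ∀ {x y} → y ≢ 0# → x * y ≡ 0# → x ≡ 0#
  x*y≡0⇒x≡0 {y = y} y≢0 xy≡0 = *-cancelʳ y≢0 (trans xy≡0 (sym (zeroˡ y)))

  x^n≡0⇒x≡0 : ∀ x n → x ^ᶠ n ≡ 0# → x ≡ 0#
  x^n≡0⇒x≡0 x ℕ.zero    1≡0   = ⊥-elim (0≢1 (sym 1≡0))
  x^n≡0⇒x≡0 x (ℕ.suc n) xxⁿ≡0 with (x ^ᶠ n) ≟ 0#
  ... | yes xⁿ≡0 = x^n≡0⇒x≡0 x n xⁿ≡0
  ... | no  xⁿ≢0 = x*y≡0⇒x≡0 xⁿ≢0 xxⁿ≡0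

  ι≡·1 : ∀ n → ι n ≡ n · 1#
  ι≡·1 ℕ.zero    = refl
  ι≡·1 (ℕ.suc n) = cong (1# +_) (ι≡·1 n)

  ι-homo-+ : ∀ m n → ι (m ℕ.+ n) ≡ ι m + ι n
  ι-homo-+ m n = trans (ι≡·1 (m ℕ.+ n)) (trans (×-homo-+ 1# m n) (sym (cong₂ _+_ (ι≡·1 m) (ι≡·1 n))))

  ι-homo-* : ∀ m n → ι (m ℕ.* n) ≡ ι m * ι n
  ι-homo-* m n = trans (ι≡·1 (m ℕ.* n)) (trans (×1-homo-* m n) (sym (cong₂ _*_ (ι≡·1 m) (ι≡·1 n))))

  ι-homo-^ : ∀ m n → ι (m ℕ.^ n) ≡ ι m ^ᶠ n
  ι-homo-^ m ℕ.zero    = +-identityʳ 1#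
  ι-homo-^ m (ℕ.suc n) = trans (ι-homo-* m (m ℕ.^ n)) (cong (ι m *_) (ι-homo-^ m n))

  ι-% : ∀ {p} .{{_ : NonZero p}} → ι p ≡ 0# → ∀ n → ι (n % p) ≡ ι n
  ι-% {p} ιp≡0 n = sym (begin
    ι n                               ≡⟨ cong ι (m≡m%n+[m/n]*n n p) ⟩
    ι (n % p ℕ.+ n / p ℕ.* p)         ≡⟨ ι-homo-+ (n % p) (n / p ℕ.* p) ⟩
    ι (n % p) + ι (n / p ℕ.* p)       ≡⟨ cong (ι (n % p) +_) (ι-homo-* (n / p) p) ⟩
    ι (n % p) + ι (n / p) * ι p       ≡⟨ cong (λ c → ι (n % p) + ι (n / p) * c) ιp≡0 ⟩
    ι (n % p) + ι (n / p) * 0#        ≡⟨ cong (ι (n % p) +_) (zeroʳ (ι (n / p))) ⟩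
    ι (n % p) + 0#                    ≡⟨ +-identityʳ (ι (n % p)) ⟩
    ι (n % p)                         ∎)

  element : Fin size → Carrier
  element = Inverse.to enum

  index : Carrier → Fin size
  index = Inverse.from enum

  element-index : ∀ x → element (index x) ≡ x
  element-index = Inverse.strictlyInverseˡ enum

  index-element : ∀ i → index (element i) ≡ i
  index-element = Inverse.strictlyInverseʳ enum

  element-≢ : ∀ {i x} → i ≢ index x → element i ≢ x
  element-≢ {i} i≢ eᵢ≡x = i≢ (trans (sym (index-element i)) (cong index eᵢ≡x))

  ∈-elements : ∀ x → x ∈ elements
  ∈-elements x = subst (_∈ elements) (element-index x) (∈-map⁺ element (∈-allFin (index x)))

  sumL-tabulate : ∀ {n} (t : Fin n → Carrier) → sumL (tabulate t) ≡ Σ.sum t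
  sumL-tabulate {ℕ.zero}  t = refl
  sumL-tabulate {ℕ.suc n} t = cong (t zero +_) (sumL-tabulate (t ∘ suc))

  sumL-map-elements : ∀ f → sumL (map f elements) ≡ Σ.sum (f ∘ element)
  sumL-map-elements f = begin
    sumL (map f (map element (allFin size))) ≡⟨ cong sumL (map-∘ (allFin size)) ⟨
    sumL (map (f ∘ element) (tabulate id))   ≡⟨ cong sumL (map-tabulate id (f ∘ element)) ⟩
    sumL (tabulate (f ∘ element))            ≡⟨ sumL-tabulate (f ∘ element) ⟩
    Σ.sum (f ∘ element)                      ∎

  sumL-count : ∀ {a ℓ} {A : Set a} {P : Pred A ℓ} (P? : Decidable P) (f : A → Carrier) →
               (∀ {x} → P x → f x ≡ 1#) → (∀ {x} → ¬ P x → f x ≡ 0#) →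
               ∀ xs → sumL (map f xs) ≡ ι (length (filter P? xs))
  sumL-count P? f f≡1 f≡0 []       = refl
  sumL-count P? f f≡1 f≡0 (x ∷ xs) with P? x
  ... | yes px = cong₂ _+_ (f≡1 px) (sumL-count P? f f≡1 f≡0 xs)
  ... | no ¬px = trans (cong₂ _+_ (f≡0 ¬px) (sumL-count P? f f≡1 f≡0 xs)) (+-identityˡ _)

  module _ {c ℓ} (M : CommutativeMonoid c ℓ) where
    open CommutativeMonoid M using (_≈_; _∙_; reflexive; ∙-congˡ) renaming (Carrier to A; trans to ≈-trans)
    open Sum M using (sum; sum-remove; ∑-permute; sum-cong-≗)

    sum-reindex : (φ : Carrier ↔ Carrier) (t : Carrier → A) → sum (t ∘ element) ≈ sum (t ∘ Inverse.to φ ∘ element)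
    sum-reindex φ t = ≈-trans (∑-permute (t ∘ element) π)
                              (reflexive (sum-cong-≗ (cong t ∘ element-index ∘ Inverse.to φ ∘ element)))
      where
      π : Fin size ↔ Fin size
      π = ↔-sym enum ↔-∘ (φ ↔-∘ enum)

    sum-const-except : ∀ {n} (t : Vector A n) j c → (∀ i → i ≢ j → t i ≡ c) → sum t ≈ t j ∙ sum (replicate (n ℕ.∸ 1) c)
    sum-const-except {ℕ.suc n} t j c t≡c =
      ≈-trans (sum-remove {i = j} t) (∙-congˡ (reflexive (sum-cong-≗ λ i → t≡c (punchIn j i) (punchInᵢ≢i j i))))

  sumL-elements-single : ∀ f d → (∀ e → e ≢ d → f e ≡ 0#) → sumL (map f elements) ≡ f d
  sumL-elements-single f d f≡0 = begin
    sumL (map f elements)                                    ≡⟨ sumL-map-elements f ⟩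
    Σ.sum (f ∘ element)                                      ≡⟨ sum-const-except +-commutativeMonoid (f ∘ element) (index d) 0# vanish ⟩
    f (element (index d)) + Σ.sum (replicate (size ℕ.∸ 1) 0#) ≡⟨ cong₂ _+_ (cong f (element-index d)) (Σ.sum-replicate-zero (size ℕ.∸ 1)) ⟩
    f d + 0#                                                 ≡⟨ +-identityʳ (f d) ⟩
    f d                                                      ∎
    where
    vanish : ∀ i → i ≢ index d → f (element i) ≡ 0#
    vanish i = f≡0 (element i) ∘ element-≢

  sumL-elements-zero : ∀ f → (∀ e → f e ≡ 0#) → sumL (map f elements) ≡ 0#
  sumL-elements-zero f f≡0 =
    trans (sumL-map-elements f) (trans (Σ.sum-cong-≗ (f≡0 ∘ element)) (Σ.sum-replicate-zero size))

  translation : Carrier → Carrier ↔ Carrier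
  translation c = mk↔ₛ′ (_+ c) (_- c) (//-rightDividesˡ c) (//-rightDividesʳ c)

  scaling : ∀ {a} → a ≢ 0# → Carrier ↔ Carrier
  scaling {a} a≢0 = mk↔ₛ′ (a *_) (a⁻¹ *_) (cancel aa⁻¹≡1) (cancel (trans (*-comm a⁻¹ a) aa⁻¹≡1))
    where
    a⁻¹ : Carrier
    a⁻¹ = proj₁ (inverse a a≢0)
    aa⁻¹≡1 : a * a⁻¹ ≡ 1#
    aa⁻¹≡1 = proj₂ (inverse a a≢0)
    cancel : ∀ {b c} → b * c ≡ 1# → ∀ x → b * (c * x) ≡ x
    cancel {b} {c} bc≡1 x = trans (sym (*-assoc b c x)) (trans (cong (_* x) bc≡1) (*-identityˡ x))

  ι[size]≡0 : ι size ≡ 0#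
  ι[size]≡0 = +-identityʳ-unique S (ι size) (sym (begin
    S                              ≡⟨ sum-reindex +-commutativeMonoid (translation 1#) id ⟩
    Σ.sum (λ i → element i + 1#)   ≡⟨ Σ.∑-distrib-+ element (λ _ → 1#) ⟩
    S + Σ.sum (replicate size 1#)  ≡⟨ cong (S +_) (Σ.sum-replicate size) ⟩
    S + size · 1#                  ≡⟨ cong (S +_) (ι≡·1 size) ⟨
    S + ι size                     ∎))
    where
    S : Carrier
    S = Σ.sum element

  ι[p]≡0 : ∀ p h → size ≡ p ℕ.^ h → ι p ≡ 0#
  ι[p]≡0 p h size≡pʰ = x^n≡0⇒x≡0 (ι p) h (begin
    ι p ^ᶠ h      ≡⟨ ι-homo-^ p h ⟨
    ι (p ℕ.^ h)   ≡⟨ cong ι size≡pʰ ⟨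
    ι size        ≡⟨ ι[size]≡0 ⟩
    0#            ∎)

  unlessZero : Carrier → Carrier → Carrier
  unlessZero x y = if does (x ≟ 0#) then 1# else y

  unlessZero-0 : ∀ y → unlessZero 0# y ≡ 1#
  unlessZero-0 y = cong (λ b → if b then 1# else y) (dec-true (0# ≟ 0#) refl)

  unlessZero-≢0 : ∀ {x} y → x ≢ 0# → unlessZero x y ≡ y
  unlessZero-≢0 {x} y x≢0 = cong (λ b → if b then 1# else y) (dec-false (x ≟ 0#) x≢0)

  ∏-nonzero : ∀ {n} (t : Vector Carrier n) → (∀ i → t i ≢ 0#) → Π.sum t ≢ 0#
  ∏-nonzero {ℕ.zero}  t t≢0 = 0≢1 ∘ sym
  ∏-nonzero {ℕ.suc n} t t≢0 = t≢0 zero ∘ x*y≡0⇒x≡0 (∏-nonzero (t ∘ suc) (t≢0 ∘ suc))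

  ∏-replicate : ∀ n a → Π.sum (replicate n a) ≡ a ^ᶠ n
  ∏-replicate ℕ.zero    a = refl
  ∏-replicate (ℕ.suc n) a = cong (a *_) (∏-replicate n a)

  -- With g 0 = 1 and g x = x otherwise, ∏ g(a x) is both ∏ g x (x ↦ a x permutes F) and a^(q-1) ∏ g x.
  x^[q∸1]≡1 : ∀ {a} → a ≢ 0# → a ^ᶠ (size ℕ.∸ 1) ≡ 1#
  x^[q∸1]≡1 {a} a≢0 = *-cancelʳ P≢0 (begin
    a ^ᶠ (size ℕ.∸ 1) * P                        ≡⟨ cong (_* P) ∏G ⟨
    Π.sum (G ∘ element) * P                      ≡⟨ Π.∑-distrib-+ (G ∘ element) (g ∘ element) ⟨
    Π.sum (λ i → G (element i) * g (element i))  ≡⟨ Π.sum-cong-≗ (g-scale ∘ element) ⟨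
    Π.sum (g ∘ (a *_) ∘ element)                 ≡⟨ sum-reindex *-commutativeMonoid (scaling a≢0) g ⟨
    P                                            ≡⟨ *-identityˡ P ⟨
    1# * P                                       ∎)
    where
    g G : Carrier → Carrier
    g x = unlessZero x x
    G x = unlessZero x a
    P : Carrier
    P = Π.sum (g ∘ element)

    g≢0 : ∀ x → g x ≢ 0#
    g≢0 x with x ≟ 0#
    ... | yes _   = 0≢1 ∘ sym
    ... | no  x≢0 = x≢0

    P≢0 : P ≢ 0#
    P≢0 = ∏-nonzero (g ∘ element) (g≢0 ∘ element)

    g-scale : ∀ x → g (a * x) ≡ G x * g x
    g-scale x with x ≟ 0#
    ... | yes x≡0 = trans (cong g (trans (cong (a *_) x≡0) (zeroʳ a))) (trans (unlessZero-0 0#) (sym (*-identityˡ 1#)))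
    ... | no  x≢0 = unlessZero-≢0 (a * x) (a≢0 ∘ x*y≡0⇒x≡0 x≢0)

    ∏G : Π.sum (G ∘ element) ≡ a ^ᶠ (size ℕ.∸ 1)
    ∏G = begin
      Π.sum (G ∘ element)                                       ≡⟨ sum-const-except *-commutativeMonoid (G ∘ element) (index 0#) a (λ i → unlessZero-≢0 a ∘ element-≢) ⟩
      G (element (index 0#)) * Π.sum (replicate (size ℕ.∸ 1) a)  ≡⟨ cong₂ _*_ (trans (cong G (element-index 0#)) (unlessZero-0 a)) (∏-replicate (size ℕ.∸ 1) a) ⟩
      1# * a ^ᶠ (size ℕ.∸ 1)                                    ≡⟨ *-identityˡ _ ⟩
      a ^ᶠ (size ℕ.∸ 1)                                         ∎

  0^[q∸1]≡0 : 0# ^ᶠ (size ℕ.∸ 1) ≡ 0#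
  0^[q∸1]≡0 = 0^n≡0 (m<n⇒0<n∸m (i≢j⇒1<n index0≢index1))
    where
    index0≢index1 : index 0# ≢ index 1#
    index0≢index1 eq = 0≢1 (trans (sym (element-index 0#)) (trans (cong element eq) (element-index 1#)))
    0^n≡0 : ∀ {n} → 0 ℕ.< n → 0# ^ᶠ n ≡ 0#
    0^n≡0 {ℕ.suc n} _ = zeroˡ (0# ^ᶠ n)

  zeroIndicator : Carrier → Carrier
  zeroIndicator z = 1# - z ^ᶠ (size ℕ.∸ 1)

  zeroIndicator-≡0 : ∀ {z} → z ≡ 0# → zeroIndicator z ≡ 1#
  zeroIndicator-≡0 refl = trans (cong (λ w → 1# - w) 0^[q∸1]≡0) (x-0≡x 1#)

  zeroIndicator-≢0 : ∀ {z} → z ≢ 0# → zeroIndicator z ≡ 0#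
  zeroIndicator-≢0 z≢0 = trans (cong (λ w → 1# - w) (x^[q∸1]≡1 z≢0)) (-‿inverseʳ 1#)

module AffinePlane (F : FiniteField) (p : ℕ) .{{_ : NonZero p}} (ιp≡0 : FiniteField.ι F p ≡ FiniteField.0# F) where
  open FiniteField F hiding (_^_)
  open FiniteFieldProperties F
  open CommutativeRing commutativeRing using (+-identityˡ; -‿inverseʳ; *-identityˡ; *-identityʳ; zeroˡ; zeroʳ; ring)
  open RingProperties ring using (-0#≈0#; x∙y⁻¹≈ε⇒x≈y; x≈y⇒x∙y⁻¹≈ε)
  open AG2 F p
  open ≡-Reasoning

  line-count : ∀ M d b → sumL (map (λ pt → zeroIndicator ((proj₂ pt * 1#) - ((d * proj₁ pt) + b))) M) ≡ ι (countLine M d b)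
  line-count M d b = sumL-count _ _
      (λ on → zeroIndicator-≡0 (x≈y⇒x∙y⁻¹≈ε (trans (*-identityʳ _) on)))
      (λ off → zeroIndicator-≢0 (off ∘ trans (sym (*-identityʳ _)) ∘ x∙y⁻¹≈ε⇒x≈y _ _))
      M

  vertical-count : ∀ M b → sumL (map (λ pt → zeroIndicator ((proj₂ pt * 0#) - ((1# * proj₁ pt) + b))) M) ≡ ι (countVert M b)
  vertical-count M b = sumL-count _ _
      (λ x+b≡0 → zeroIndicator-≡0 (trans (y0-[1x+b]≡-[x+b] _ _) (trans (cong -_ x+b≡0) -0#≈0#)))
      (λ x+b≢0 → zeroIndicator-≢0 (x+b≢0 ∘ -x≡0⇒x≡0 ∘ trans (sym (y0-[1x+b]≡-[x+b] _ _))))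
      M
    where
    y0-[1x+b]≡-[x+b] : ∀ x y → (y * 0#) - ((1# * x) + b) ≡ - (x + b)
    y0-[1x+b]≡-[x+b] x y = trans (cong₂ _+_ (zeroʳ y) (cong (λ w → - (w + b)) (*-identityˡ x))) (+-identityˡ _)

  weight : Multiset → Carrier → Carrier
  weight M e = if inE M e then ι (r M e) else 0#

  weight-* : ∀ M e y → (if inE M e then ι (r M e) * y else 0#) ≡ weight M e * y
  weight-* M e y with inE M e
  ... | true  = refl
  ... | false = sym (zeroˡ y)

  FM-affine : ∀ M d b → FM M 1# d b ≡ ι (countLine M d b) - weight M d
  FM-affine M d b = cong₂ _-_ (line-count M d b) (begin
    sumL (map term elements)                 ≡⟨ sumL-elements-single term d vanish ⟩
    term d                                   ≡⟨ weight-* M d _ ⟩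
    weight M d * zeroIndicator (d - d * 1#)  ≡⟨ cong (weight M d *_) (zeroIndicator-≡0 (x≈y⇒x∙y⁻¹≈ε (sym (*-identityʳ d)))) ⟩
    weight M d * 1#                          ≡⟨ *-identityʳ (weight M d) ⟩
    weight M d                               ∎)
    where
    term : Carrier → Carrier
    term e = if inE M e then ι (r M e) * zeroIndicator (d - e * 1#) else 0#
    vanish : ∀ e → e ≢ d → term e ≡ 0#
    vanish e e≢d = trans (weight-* M e _) (trans (cong (weight M e *_) (zeroIndicator-≢0 d-e≢0)) (zeroʳ _))
      where
      d-e≢0 : d - e * 1# ≢ 0#
      d-e≢0 d-e≡0 = e≢d (sym (trans (x∙y⁻¹≈ε⇒x≈y _ _ d-e≡0) (*-identityʳ e)))

  FM-vertical : ∀ M b → FM M 0# 1# b ≡ ι (countVert M b)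
  FM-vertical M b = trans (cong₂ _-_ (vertical-count M b) (sumL-elements-zero term vanish)) (x-0≡x _)
    where
    term : Carrier → Carrier
    term e = if inE M e then ι (r M e) * zeroIndicator (1# - e * 0#) else 0#
    vanish : ∀ e → term e ≡ 0#
    vanish e = trans (weight-* M e _) (trans (cong (weight M e *_) (zeroIndicator-≢0 1-0≢0)) (zeroʳ _))
      where
      1-0≢0 : 1# - e * 0# ≢ 0#
      1-0≢0 1-0≡0 = 0≢1 (sym (trans (x∙y⁻¹≈ε⇒x≈y _ _ 1-0≡0) (zeroʳ e)))

  -- Built with map′ so that its `does` is inE M d on the nose.
  equidistributed? : ∀ M d → Dec (ModEquidistributed M d)
  equidistributed? M d =
    map′ (λ all b b′ → trans (at all b) (sym (at all b′))) (λ eq → All.tabulate (λ {b} _ → eq b 0#))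
         (All.all? (λ b → pr M d b ℕ.≟ pr M d 0#) elements)
    where
    at : All (λ b → pr M d b ≡ pr M d 0#) elements → ∀ b → pr M d b ≡ pr M d 0#
    at all b = All.lookup all (∈-elements b)

  FM-equidistributed : ∀ M d b → ModEquidistributed M d → FM M 1# d b ≡ 0#
  FM-equidistributed M d b eq = begin
    FM M 1# d b                        ≡⟨ FM-affine M d b ⟩
    ι (countLine M d b) - weight M d   ≡⟨ cong (λ c → ι (countLine M d b) - (if c then ι (r M d) else 0#)) (dec-true (equidistributed? M d) eq) ⟩
    ι (countLine M d b) - ι (r M d)    ≡⟨ cong (_- ι (r M d)) (ι-% ιp≡0 (countLine M d b)) ⟨
    ι (pr M d b) - ι (r M d)           ≡⟨ cong (λ n → ι n - ι (r M d)) (eq b 0#) ⟩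
    ι (r M d) - ι (r M d)              ≡⟨ -‿inverseʳ (ι (r M d)) ⟩
    0#                                 ∎

  FM-special : ∀ M d b → ¬ ModEquidistributed M d → FM M 1# d b ≡ ι (pr M d b)
  FM-special M d b ¬eq = begin
    FM M 1# d b                        ≡⟨ FM-affine M d b ⟩
    ι (countLine M d b) - weight M d   ≡⟨ cong (λ c → ι (countLine M d b) - (if c then ι (r M d) else 0#)) (dec-false (equidistributed? M d) ¬eq) ⟩
    ι (countLine M d b) - 0#           ≡⟨ x-0≡x _ ⟩
    ι (countLine M d b)                ≡⟨ ι-% ιp≡0 (countLine M d b) ⟨
    ι (pr M d b)                       ∎

  FM-∞ : ∀ M b → FM M 0# 1# b ≡ ι (pr∞ M b)
  FM-∞ M b = trans (FM-vertical M b) (sym (ι-% ιp≡0 (countVert M b)))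

proposition3p6 : (p h : ℕ) .{{_ : NonZero p}} → Prime p →
    (F : FiniteField) → FiniteField.size F ≡ p ^ h →
    (M : AG2.Multiset F p) →
    ¬ AG2.ModEquidistributed∞ F p M →
    (∀ (d b : FiniteField.Carrier F) →
        (AG2.ModEquidistributed F p M d →
           AG2.FM F p M (FiniteField.1# F) d b ≡ FiniteField.0# F)
      × (¬ AG2.ModEquidistributed F p M d →
           AG2.FM F p M (FiniteField.1# F) d b ≡ FiniteField.ι F (AG2.pr F p M d b)))
    × (∀ (b : FiniteField.Carrier F) →
        AG2.FM F p M (FiniteField.0# F) (FiniteField.1# F) b ≡ FiniteField.ι F (AG2.pr∞ F p M b))
proposition3p6 p h _ F size≡pʰ M _ = (λ d b → FM-equidistributed M d b , FM-special M d b) , FM-∞ M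
  where open AffinePlane F p (FiniteFieldProperties.ι[p]≡0 F p h size≡pʰ)
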